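{- Let $a\in\mathbb{C}$. The $(4,a)$-autonomous coefficients satisfy $\left[{n\atop n}\right]_{(4,a)}=a$ for all $n\ge0$, $\left[{n\atop n-1}\right]_{(4,a)}=a\binom{n}{2}$ for all $n\ge1$, and $\left[{n\atop n-2}\right]_{(4,a)}=a\left\{{n\atop n-2}\right\}$ for all $n\ge2$, where $\left\{{n\atop m}\right\}$ denotes the Stirling number of the second kind.
   Context: The complete exponential Bell polynomials $B_n$ are defined by $\exp\left(\sum_{m\ge1}y_mt^m/m!\right)=\sum_{n\ge0}B_n(y_1,\dots,y_n)t^n/n!$. With $k=4$ and $\mathbf{x}=(x_1,x_2,x_3,x_4)$, define $f_j(\mathbf{x},a)=x_{j+1}$ for $0\le j\le3$, $f_4(\mathbf{x},a)=ae^{x_1}$ and $f_{n+4}(\mathbf{x},a)=ae^{x_1}B_n(f_1(\mathbf{x},a),\dots,f_n(\mathbf{x},a))$ for $n\ge1$. The autonomous polynomials are $A^{(4)}_n(x,a)=f_n((0,x,x,x),a)$, and the $(4,a)$-autonomous coefficients $\left[{n\atop i}\right]_{(4,a)}$ are defined by $A^{(4)}_{n+4}(x,a)=\sum_{i=0}^{n}\left[{n\atop i}\right]_{(4,a)}x^i$. -}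

module Defs where

open import Level using (Level)
open import Data.Nat as ℕ using (ℕ; zero; suc; _∸_)
open import Data.Nat.Combinatorics using (_C_)
open import Data.List using (List; []; _∷_; _++_; map; foldr; upTo)
open import Algebra.Bundles using (CommutativeRing)

stirling2 : ℕ → ℕ → ℕ
stirling2 zero    zero    = 1
stirling2 zero    (suc k) = 0
stirling2 (suc n) zero    = 0
stirling2 (suc n) (suc k) = suc k ℕ.* stirling2 n (suc k) ℕ.+ stirling2 n k

module Autonomous {c ℓ : Level} (R : CommutativeRing c ℓ) where
  open CommutativeRing R

  fromℕ : ℕ → Carrier
  fromℕ zero    = 0#
  fromℕ (suc n) = 1# + fromℕ n

  -- univariate polynomials over R in the variable x, as coefficient lists
  -- (lowest degree first)
  Poly : Set c
  Poly = List Carrier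

  infixl 6 _+ₚ_
  infixl 7 _*ₚ_

  _+ₚ_ : Poly → Poly → Poly
  []      +ₚ q       = q
  (p ∷ ps) +ₚ []      = p ∷ ps
  (p ∷ ps) +ₚ (q ∷ qs) = (p + q) ∷ (ps +ₚ qs)

  _*ₚ_ : Poly → Poly → Poly
  []       *ₚ q = []
  (p ∷ ps) *ₚ q = map (p *_) q +ₚ (0# ∷ (ps *ₚ q))

  constₚ : Carrier → Poly
  constₚ r = r ∷ []

  0ₚ 1ₚ Xₚ : Poly
  0ₚ = []
  1ₚ = constₚ 1#
  Xₚ = 0# ∷ 1# ∷ []

  coeff : Poly → ℕ → Carrier
  coeff []       _       = 0#
  coeff (p ∷ ps) zero    = p
  coeff (p ∷ ps) (suc i) = coeff ps i

  sumₚ : List Poly → Poly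
  sumₚ = foldr _+ₚ_ 0ₚ

  nth : List Poly → ℕ → Poly
  nth []       _       = 0ₚ
  nth (p ∷ ps) zero    = p
  nth (p ∷ ps) (suc i) = nth ps i

  -- Complete exponential Bell polynomials B_0,…,B_n evaluated at y_1,y_2,…,
  -- via the recurrence B_0 = 1, B_{n+1} = Σ_{k=0}^{n} C(n,k) y_{k+1} B_{n-k},
  -- equivalent to exp(Σ y_m t^m/m!) = Σ B_n t^n/n!.
  bellList : (ℕ → Poly) → ℕ → List Poly
  bellList y zero    = 1ₚ ∷ []
  bellList y (suc n) =
    let L = bellList y n in
    L ++ (sumₚ (map (λ k → constₚ (fromℕ (n C k)) *ₚ y (suc k) *ₚ nth L (n ∸ k))
                    (upTo (suc n))) ∷ [])

  bell : (ℕ → Poly) → ℕ → Poly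
  bell y n = nth (bellList y n) n

  -- Given the list [A_0,…,A_{m-1}], compute A_m = f_m((0,x,x,x),a):
  -- f_0 = x_1 ↦ 0, f_1,f_2,f_3 = x_2,x_3,x_4 ↦ x, f_4 = a e^{x_1} ↦ a,
  -- f_{n+4} = a e^{x_1} B_n(f_1,…,f_n) ↦ a B_n(A_1,…,A_n).
  step : Carrier → List Poly → ℕ → Poly
  step a L zero                         = 0ₚ
  step a L (suc zero)                   = Xₚ
  step a L (suc (suc zero))             = Xₚ
  step a L (suc (suc (suc zero)))       = Xₚ
  step a L (suc (suc (suc (suc n))))    = constₚ a *ₚ bell (nth L) n

  table : Carrier → ℕ → List Poly
  table a zero    = []
  table a (suc m) = let L = table a m in L ++ (step a L m ∷ [])

  A4 : Carrier → ℕ → Poly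
  A4 a m = step a (table a m) m

  autCoeff : Carrier → ℕ → ℕ → Carrier
  autCoeff a n i = coeff (A4 a (n ℕ.+ 4)) i

-- Write A_m for the autonomous polynomials and B_n for B_n(A_1, …, A_n), so that
-- A_1 = A_2 = A_3 = x and A_{n+4} = a B_n. In the Bell recurrence
-- B_{n+1} = Σ_{k ≤ n} C(n,k) A_{k+1} B_{n-k}, the factor A_{k+1} has degree at most
-- k + 1 - min(k,3), so by strong induction deg B_n ≤ n and the k-th summand has degree
-- at most n + 1 - min(k,3). Hence for j ≤ 2 the coefficient of x^{n+1-j} in B_{n+1}
-- only sees the summands k ≤ j, which are C(n,k) x B_{n-k}. This gives recurrences for
-- the three top coefficients of B_n, solved by 1, C(n,2) and S(n,n-2).
module Submission where

open import Defs
open import Level using (Level)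
open import Data.Nat using (ℕ; _≤_; _∸_)
open import Data.Nat.Combinatorics using (_C_)
open import Data.Product using (_×_)
open import Algebra.Bundles using (CommutativeRing)

open import Data.Nat as ℕ using (zero; suc; _<_; _⊓_; _⊔_; z≤n; s≤s)
open import Data.Nat.Properties
  using (≤-refl; ≤-reflexive; ≤-trans; <-≤-trans; <⇒≤; ≤-pred; n≤1+n; m<n⇒m<1+n; m≤n+m;
         m<n+m; m∸n≤m; m⊓n≤n; m≤n⇒m≤1+n; m≤n⇒m<n∨m≡n; ⊔-lub)
import Data.Nat.Properties as ℕₚ
open import Data.Nat.Induction using (<-rec)
open import Data.Nat.Combinatorics using (nC1≡n; nCk+nC[k+1]≡[n+1]C[k+1])
open import Data.Product using (_,_)
open import Data.Sum using (inj₁; inj₂)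
open import Data.List using (List; []; _∷_; _++_; map; length; applyUpTo; upTo)
open import Data.List.Properties using (length-map; length-++; map-cong; map-cong-local)
open import Data.List.Relation.Unary.All.Properties using (map⁺; applyUpTo⁺₁; all-upTo)
open import Function using (id; _∘_)
open import Relation.Binary.PropositionalEquality as ≡ using (_≡_)

module _ where
  open import Data.Nat using (_+_; _*_)
  open import Data.Nat.Properties using (*-zeroʳ; *-identityʳ; *-distribˡ-+; n<1+n; +-∸-comm; m+[n∸m]≡n)
  open import Data.Nat.Tactic.RingSolver using (solve)
  open ≡ using (refl; sym; trans; cong)
  open ℕₚ using (+-comm)

  n<k⇒stirling2[n,k]≡0 : ∀ {n k} → n < k → stirling2 n k ≡ 0
  n<k⇒stirling2[n,k]≡0 {zero}  {suc k} _ = refl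
  n<k⇒stirling2[n,k]≡0 {suc n} {suc k} (s≤s n<k)
    rewrite n<k⇒stirling2[n,k]≡0 (m≤n⇒m≤1+n n<k) | n<k⇒stirling2[n,k]≡0 n<k
    = cong (_+ 0) (*-zeroʳ (suc k))

  stirling2[n,n]≡1 : ∀ n → stirling2 n n ≡ 1
  stirling2[n,n]≡1 zero = refl
  stirling2[n,n]≡1 (suc n)
    rewrite n<k⇒stirling2[n,k]≡0 (n<1+n n) | stirling2[n,n]≡1 n
    = cong (_+ 1) (*-zeroʳ (suc n))

  [1+n]C2≡n+nC2 : ∀ n → suc n C 2 ≡ n + n C 2
  [1+n]C2≡n+nC2 n = begin
    suc n C 2        ≡⟨ nCk+nC[k+1]≡[n+1]C[k+1] n 1 ⟨
    n C 1 + n C 2    ≡⟨ cong (_+ n C 2) (nC1≡n n) ⟩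
    n + n C 2        ∎
    where open ≡.≡-Reasoning

  stirling2[1+n,n]≡[1+n]C2 : ∀ n → stirling2 (suc n) n ≡ suc n C 2
  stirling2[1+n,n]≡[1+n]C2 zero = refl
  stirling2[1+n,n]≡[1+n]C2 (suc n)
    rewrite stirling2[n,n]≡1 (suc n) | stirling2[1+n,n]≡[1+n]C2 n | [1+n]C2≡n+nC2 (suc n)
    = cong (_+ suc n C 2) (*-identityʳ (suc n))

  2*[1+n]C2≡n*[1+n] : ∀ n → 2 * (suc n C 2) ≡ n * suc n
  2*[1+n]C2≡n*[1+n] zero = refl
  2*[1+n]C2≡n*[1+n] (suc n) = begin
    2 * (suc (suc n) C 2)        ≡⟨ cong (2 *_) ([1+n]C2≡n+nC2 (suc n)) ⟩
    2 * (suc n + suc n C 2)      ≡⟨ *-distribˡ-+ 2 (suc n) (suc n C 2) ⟩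
    2 * suc n + 2 * (suc n C 2)  ≡⟨ cong (2 * suc n +_) (2*[1+n]C2≡n*[1+n] n) ⟩
    2 * suc n + n * suc n        ≡⟨ solve (n ∷ []) ⟩
    suc n * suc (suc n)          ∎
    where open ≡.≡-Reasoning

  stirling2[3+n,1+n] : ∀ n → stirling2 (3 + n) (1 + n)
                           ≡ stirling2 (2 + n) n + ((2 + n) * ((1 + n) C 2) + (2 + n) C 2)
  stirling2[3+n,1+n] n
    rewrite stirling2[1+n,n]≡[1+n]C2 (1 + n) | [1+n]C2≡n+nC2 (1 + n)
    = trans (+-comm ((1 + n) * ((1 + n) + c)) _)
            (cong (stirling2 (2 + n) n +_) ([1+n]*[[1+n]+x] c (2*[1+n]C2≡n*[1+n] n)))
    where
    open ≡.≡-Reasoning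
    c = (1 + n) C 2
    -- Stated for a variable x because the ring solver cannot abstract the term (1 + n) C 2.
    [1+n]*[[1+n]+x] : ∀ x → 2 * x ≡ n * (1 + n) → (1 + n) * ((1 + n) + x) ≡ (2 + n) * x + ((1 + n) + x)
    [1+n]*[[1+n]+x] x 2x≡n[1+n] = begin
      (1 + n) * ((1 + n) + x)              ≡⟨ solve (n ∷ x ∷ []) ⟩
      (1 + n) * x + (1 + n) + n * (1 + n)  ≡⟨ cong ((1 + n) * x + (1 + n) +_) 2x≡n[1+n] ⟨
      (1 + n) * x + (1 + n) + 2 * x        ≡⟨ solve (n ∷ x ∷ []) ⟩
      (2 + n) * x + ((1 + n) + x)          ∎

  [m∸o]+[n∸m]≡n∸o : ∀ {m n o} → o ≤ m → m ≤ n → (m ∸ o) + (n ∸ m) ≡ n ∸ o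
  [m∸o]+[n∸m]≡n∸o {m} {n} {o} o≤m m≤n =
    trans (sym (+-∸-comm (n ∸ m) o≤m)) (cong (_∸ o) (m+[n∸m]≡n m≤n))

module PolynomialProperties {c ℓ : Level} (R : CommutativeRing c ℓ) where
  open import Data.List.Relation.Unary.All as All using (All; []; _∷_)
  open CommutativeRing R
  open Autonomous R
  open import Algebra.Properties.Semiring.Mult semiring using (×-homo-+; ×1-homo-*) renaming (_×_ to _·_)
  open import Relation.Binary.Reasoning.Setoid setoid

  fromℕ≡·1# : ∀ n → fromℕ n ≡ n · 1#
  fromℕ≡·1# zero    = ≡.refl
  fromℕ≡·1# (suc n) = ≡.cong (1# +_) (fromℕ≡·1# n)

  fromℕ-+ : ∀ m n → fromℕ (m ℕ.+ n) ≈ fromℕ m + fromℕ n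
  fromℕ-+ m n rewrite fromℕ≡·1# (m ℕ.+ n) | fromℕ≡·1# m | fromℕ≡·1# n = ×-homo-+ 1# m n

  fromℕ-* : ∀ m n → fromℕ (m ℕ.* n) ≈ fromℕ m * fromℕ n
  fromℕ-* m n rewrite fromℕ≡·1# (m ℕ.* n) | fromℕ≡·1# m | fromℕ≡·1# n = ×1-homo-* m n

  fromℕ[1]*x≈x : ∀ x → fromℕ 1 * x ≈ x
  fromℕ[1]*x≈x x = trans (*-congʳ (+-identityʳ 1#)) (*-identityˡ x)

  coeff-+ₚ : ∀ p q i → coeff (p +ₚ q) i ≈ coeff p i + coeff q i
  coeff-+ₚ []       q        i       = sym (+-identityˡ _)
  coeff-+ₚ (_ ∷ _)  []       i       = sym (+-identityʳ _)
  coeff-+ₚ (_ ∷ _)  (_ ∷ _)  zero    = refl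
  coeff-+ₚ (_ ∷ p)  (_ ∷ q)  (suc i) = coeff-+ₚ p q i

  coeff-map-* : ∀ r p i → coeff (map (r *_) p) i ≈ r * coeff p i
  coeff-map-* r []      i       = sym (zeroʳ r)
  coeff-map-* r (_ ∷ _) zero    = refl
  coeff-map-* r (_ ∷ p) (suc i) = coeff-map-* r p i

  coeff-∷-*ₚ : ∀ r p q i → coeff ((r ∷ p) *ₚ q) i ≈ r * coeff q i + coeff (0# ∷ p *ₚ q) i
  coeff-∷-*ₚ r p q i = trans (coeff-+ₚ (map (r *_) q) _ i) (+-congʳ (coeff-map-* r q i))

  coeff-constₚ-*ₚ : ∀ r q i → coeff (constₚ r *ₚ q) i ≈ r * coeff q i
  coeff-constₚ-*ₚ r q i = trans (coeff-∷-*ₚ r [] q i) (trans (+-congˡ (coeff-0#∷[] i)) (+-identityʳ _))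
    where
    coeff-0#∷[] : ∀ i → coeff (0# ∷ []) i ≈ 0#
    coeff-0#∷[] zero    = refl
    coeff-0#∷[] (suc i) = refl

  -- constₚ c *ₚ Xₚ is the list (c * 0# + 0#) ∷ c * 1# ∷ [].
  coeff-cX*ₚ-zero : ∀ c p → coeff (constₚ c *ₚ Xₚ *ₚ p) 0 ≈ 0#
  coeff-cX*ₚ-zero c p = begin
    coeff (constₚ c *ₚ Xₚ *ₚ p) 0              ≈⟨ coeff-∷-*ₚ (c * 0# + 0#) (c * 1# ∷ []) p 0 ⟩
    (c * 0# + 0#) * coeff p 0 + 0#             ≈⟨ +-identityʳ _ ⟩
    (c * 0# + 0#) * coeff p 0                  ≈⟨ *-congʳ (trans (+-identityʳ _) (zeroʳ c)) ⟩
    0# * coeff p 0                             ≈⟨ zeroˡ _ ⟩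
    0#                                         ∎

  coeff-cX*ₚ-suc : ∀ c p i → coeff (constₚ c *ₚ Xₚ *ₚ p) (suc i) ≈ c * coeff p i
  coeff-cX*ₚ-suc c p i = begin
    coeff (constₚ c *ₚ Xₚ *ₚ p) (suc i)                       ≈⟨ coeff-∷-*ₚ (c * 0# + 0#) (c * 1# ∷ []) p (suc i) ⟩
    (c * 0# + 0#) * coeff p (suc i) + coeff (constₚ (c * 1#) *ₚ p) i
                                                              ≈⟨ +-cong (*-congʳ (trans (+-identityʳ _) (zeroʳ c))) (coeff-constₚ-*ₚ (c * 1#) p i) ⟩
    0# * coeff p (suc i) + c * 1# * coeff p i                 ≈⟨ +-cong (zeroˡ _) (*-congʳ (*-identityʳ c)) ⟩
    0# + c * coeff p i                                        ≈⟨ +-identityˡ _ ⟩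
    c * coeff p i                                             ∎

  -- A bound on the length of the coefficient list, which may carry trailing zeros.
  infix 4 _HasDegree≤_
  _HasDegree≤_ : Poly → ℕ → Set
  p HasDegree≤ d = length p ≤ suc d

  degree-mono : ∀ p {d e} → p HasDegree≤ d → d ≤ e → p HasDegree≤ e
  degree-mono _ p≤d d≤e = ≤-trans p≤d (s≤s d≤e)

  coeff-beyond-length : ∀ p {i} → length p ≤ i → coeff p i ≡ 0#
  coeff-beyond-length []      _          = ≡.refl
  coeff-beyond-length (_ ∷ p) (s≤s p≤i)  = coeff-beyond-length p p≤i

  coeff-beyond-degree : ∀ p {d i} → p HasDegree≤ d → d < i → coeff p i ≡ 0#
  coeff-beyond-degree p p≤d d<i = coeff-beyond-length p (≤-trans p≤d d<i)

  length-+ₚ : ∀ p q → length (p +ₚ q) ≡ length p ⊔ length q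
  length-+ₚ []      q       = ≡.refl
  length-+ₚ (_ ∷ _) []      = ≡.refl
  length-+ₚ (_ ∷ p) (_ ∷ q) = ≡.cong suc (length-+ₚ p q)

  +ₚ-degree : ∀ p q {d} → p HasDegree≤ d → q HasDegree≤ d → p +ₚ q HasDegree≤ d
  +ₚ-degree p q p≤d q≤d = ≤-trans (≤-reflexive (length-+ₚ p q)) (⊔-lub p≤d q≤d)

  sumₚ-degree : ∀ {ps d} → All (_HasDegree≤ d) ps → sumₚ ps HasDegree≤ d
  sumₚ-degree []                    = z≤n
  sumₚ-degree {p ∷ ps} (p≤d ∷ ps≤d) = +ₚ-degree p (sumₚ ps) p≤d (sumₚ-degree ps≤d)

  map-*-degree : ∀ r q {d} → q HasDegree≤ d → map (r *_) q HasDegree≤ d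
  map-*-degree r q q≤d = ≤-trans (≤-reflexive (length-map (r *_) q)) q≤d

  *ₚ-degree : ∀ p q {d₁ d₂} → p HasDegree≤ d₁ → q HasDegree≤ d₂ → p *ₚ q HasDegree≤ d₁ ℕ.+ d₂
  *ₚ-degree []    _ _ _ = z≤n
  *ₚ-degree (r ∷ []) q {d₁} {d₂} _ q≤d₂ =
    +ₚ-degree (map (r *_) q) (0# ∷ []) (map-*-degree r q (degree-mono q q≤d₂ (m≤n+m d₂ d₁))) (s≤s z≤n)
  *ₚ-degree (r ∷ _ ∷ _) _ {zero} (s≤s ()) _
  *ₚ-degree (r ∷ p@(_ ∷ _)) q {suc d₁} {d₂} (s≤s p≤d₁) q≤d₂ =
    +ₚ-degree (map (r *_) q) (0# ∷ p *ₚ q) (map-*-degree r q (degree-mono q q≤d₂ (m≤n+m d₂ (suc d₁))))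
              (s≤s (*ₚ-degree p q p≤d₁ q≤d₂))

  nth-++-< : ∀ ps qs {k} → k < length ps → nth (ps ++ qs) k ≡ nth ps k
  nth-++-< (_ ∷ _)  _  {zero}  _         = ≡.refl
  nth-++-< (_ ∷ ps) qs {suc k} (s≤s k<) = nth-++-< ps qs k<

  nth-++-length : ∀ ps q qs {k} → length ps ≡ k → nth (ps ++ q ∷ qs) k ≡ q
  nth-++-length []       _ _ ≡.refl = ≡.refl
  nth-++-length (_ ∷ ps) q qs ≡.refl = nth-++-length ps q qs ≡.refl

  length-++-[x] : ∀ (ps : List Poly) q → length (ps ++ q ∷ []) ≡ suc (length ps)
  length-++-[x] ps q = ≡.trans (length-++ ps) (ℕₚ.+-comm (length ps) 1)

  length-bellList : ∀ y n → length (bellList y n) ≡ suc n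
  length-bellList y zero    = ≡.refl
  length-bellList y (suc n) = ≡.trans (length-++-[x] (bellList y n) _) (≡.cong suc (length-bellList y n))

  nth-bellList : ∀ y {n k} → k ≤ n → nth (bellList y n) k ≡ bell y k
  nth-bellList y {zero} z≤n = ≡.refl
  nth-bellList y {suc n} {k} k≤1+n with m≤n⇒m<n∨m≡n k≤1+n
  ... | inj₁ k<1+n = ≡.trans (nth-++-< (bellList y n) _ (≤-trans k<1+n (≤-reflexive (≡.sym (length-bellList y n)))))
                             (nth-bellList y (≤-pred k<1+n))
  ... | inj₂ ≡.refl = ≡.refl

  bellList-cong : ∀ {y y′} n → (∀ {k} → k < n → y (suc k) ≡ y′ (suc k)) → bellList y n ≡ bellList y′ n
  bellList-cong zero _ = ≡.refl
  bellList-cong {y} {y′} (suc n) y≗y′ = ≡.trans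
    (≡.cong (λ L → L ++ sumₚ (map (λ k → constₚ (fromℕ (n C k)) *ₚ y (suc k) *ₚ nth L (n ∸ k)) (upTo (suc n))) ∷ [])
            (bellList-cong n (y≗y′ ∘ m<n⇒m<1+n)))
    (≡.cong (λ ts → bellList y′ n ++ sumₚ ts ∷ [])
            (map-cong-local (All.map (λ k<1+n → ≡.cong (λ p → constₚ _ *ₚ p *ₚ _) (y≗y′ k<1+n)) (all-upTo (suc n)))))

module AutonomousCoefficients {c ℓ : Level} (R : CommutativeRing c ℓ) (a : CommutativeRing.Carrier R) where
  open CommutativeRing R
  open Autonomous R
  open PolynomialProperties R
  open import Relation.Binary.Reasoning.Setoid setoid

  A : ℕ → Poly
  A = A4 a

  B : ℕ → Poly
  B = bell A

  length-table : ∀ m → length (table a m) ≡ m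
  length-table zero    = ≡.refl
  length-table (suc m) = ≡.trans (length-++-[x] (table a m) (A m)) (≡.cong suc (length-table m))

  nth-table : ∀ {m k} → k < m → nth (table a m) k ≡ A k
  nth-table {suc m} {k} k<1+m with m≤n⇒m<n∨m≡n (≤-pred k<1+m)
  ... | inj₁ k<m  = ≡.trans (nth-++-< (table a m) _ (≤-trans k<m (≤-reflexive (≡.sym (length-table m)))))
                            (nth-table k<m)
  ... | inj₂ ≡.refl = nth-++-length (table a k) (A k) [] (length-table k)

  A[4+n]≡a*B[n] : ∀ n → A (4 ℕ.+ n) ≡ constₚ a *ₚ B n
  A[4+n]≡a*B[n] n = ≡.cong (λ L → constₚ a *ₚ nth L n)
    (bellList-cong n (λ k<n → nth-table (s≤s (≤-trans k<n (m≤n+m n 3)))))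

  bellTerm : ℕ → ℕ → Poly
  bellTerm n k = constₚ (fromℕ (n C k)) *ₚ A (suc k) *ₚ B (n ∸ k)

  bellTerms : ℕ → (ℕ → ℕ) → ℕ → Poly
  bellTerms n f m = sumₚ (map (bellTerm n) (applyUpTo f m))

  B-suc : ∀ n → B (suc n) ≡ bellTerms n id (suc n)
  B-suc n = ≡.trans
    (nth-++-length (bellList A n) _ [] (length-bellList A n))
    (≡.cong sumₚ (map-cong (λ k → ≡.cong (constₚ (fromℕ (n C k)) *ₚ A (suc k) *ₚ_) (nth-bellList A (m∸n≤m n k)))
                           (upTo (suc n))))

  A-degree : ∀ k → (∀ {j} → j < k → B j HasDegree≤ j) → A (suc k) HasDegree≤ suc k ∸ 3 ⊓ k
  A-degree 0 _ = ≤-refl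
  A-degree 1 _ = ≤-refl
  A-degree 2 _ = ≤-refl
  A-degree (suc (suc (suc k))) B≤ rewrite A[4+n]≡a*B[n] k =
    degree-mono (constₚ a *ₚ B k) (*ₚ-degree (constₚ a) (B k) ≤-refl (B≤ (m<n+m k (s≤s z≤n)))) (n≤1+n k)

  bellTerm-degree : ∀ {n k} → (∀ {j} → j ≤ n → B j HasDegree≤ j) → k ≤ n →
                    bellTerm n k HasDegree≤ suc n ∸ 3 ⊓ k
  bellTerm-degree {n} {k} B≤ k≤n =
    degree-mono (bellTerm n k)
      (*ₚ-degree (constₚ _ *ₚ A (suc k)) (B (n ∸ k))
         (*ₚ-degree (constₚ _) (A (suc k)) ≤-refl (A-degree k (λ j<k → B≤ (<⇒≤ (<-≤-trans j<k k≤n)))))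
         (B≤ (m∸n≤m n k)))
      (≤-reflexive ([m∸o]+[n∸m]≡n∸o (m≤n⇒m≤1+n (m⊓n≤n 3 k)) (s≤s k≤n)))

  B-degree : ∀ n → B n HasDegree≤ n
  B-degree = <-rec (λ n → B n HasDegree≤ n) B-degree-step
    where
    B-degree-step : ∀ n → (∀ {j} → j < n → B j HasDegree≤ j) → B n HasDegree≤ n
    B-degree-step zero    _  = ≤-refl
    B-degree-step (suc n) B≤ rewrite B-suc n =
      sumₚ-degree (map⁺ {f = bellTerm n} (applyUpTo⁺₁ id (suc n) (λ {k} k<1+n →
        degree-mono (bellTerm n k) (bellTerm-degree (B≤ ∘ s≤s) (≤-pred k<1+n)) (m∸n≤m (suc n) (3 ⊓ k)))))

  coeff-bellTerms-beyond : ∀ m n f → (∀ {k} → k < n → f k ≤ m) → (∀ k → suc m ∸ 3 ⊓ f k ≤ n) →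
                           coeff (bellTerms m f n) (suc n) ≡ 0#
  coeff-bellTerms-beyond m n f f≤m deg≤n = coeff-beyond-degree (bellTerms m f n)
    (sumₚ-degree (map⁺ {f = bellTerm m} (applyUpTo⁺₁ f n (λ {k} k<n →
       degree-mono (bellTerm m (f k)) (bellTerm-degree (λ {j} _ → B-degree j) (f≤m k<n)) (deg≤n k)))))
    ≤-refl

  coeff-bellTerms-suc : ∀ n f m i →
    coeff (bellTerms n f (suc m)) i ≈ coeff (bellTerm n (f 0)) i + coeff (bellTerms n (f ∘ suc) m) i
  coeff-bellTerms-suc n f m i = coeff-+ₚ (bellTerm n (f 0)) (bellTerms n (f ∘ suc) m) i

  coeff-B-suc : ∀ n i → coeff (B (suc n)) i ≈ coeff (bellTerms n id (suc n)) i
  coeff-B-suc n i = reflexive (≡.cong (λ p → coeff p i) (B-suc n))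

  coeff-B[n][n]≈1# : ∀ n → coeff (B n) n ≈ 1#
  coeff-B[n][n]≈1# zero    = refl
  coeff-B[n][n]≈1# (suc n) = begin
    coeff (B (suc n)) (suc n)                                          ≈⟨ coeff-B-suc n (suc n) ⟩
    coeff (bellTerms n id (suc n)) (suc n)                             ≈⟨ coeff-bellTerms-suc n id n (suc n) ⟩
    coeff (bellTerm n 0) (suc n) + coeff (bellTerms n suc n) (suc n)
      ≈⟨ +-cong (coeff-cX*ₚ-suc (fromℕ 1) (B n) n)
                (reflexive (coeff-bellTerms-beyond n n suc id (λ k → m∸n≤m n (2 ⊓ k)))) ⟩
    fromℕ 1 * coeff (B n) n + 0#                                       ≈⟨ +-identityʳ _ ⟩
    fromℕ 1 * coeff (B n) n                                            ≈⟨ fromℕ[1]*x≈x _ ⟩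
    coeff (B n) n                                                      ≈⟨ coeff-B[n][n]≈1# n ⟩
    1#                                                                 ∎

  coeff-B[1+n][n]≈[1+n]C2 : ∀ n → coeff (B (suc n)) n ≈ fromℕ (suc n C 2)
  coeff-B[1+n][n]≈[1+n]C2 zero = begin
    coeff (B 1) 0                                            ≈⟨ coeff-B-suc 0 0 ⟩
    coeff (bellTerms 0 id 1) 0                               ≈⟨ coeff-bellTerms-suc 0 id 0 0 ⟩
    coeff (bellTerm 0 0) 0 + 0#                              ≈⟨ +-identityʳ _ ⟩
    coeff (bellTerm 0 0) 0                                   ≈⟨ coeff-cX*ₚ-zero (fromℕ 1) (B 0) ⟩
    0#                                                       ∎
  coeff-B[1+n][n]≈[1+n]C2 (suc n) = begin
    coeff (B (suc (suc n))) (suc n)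
      ≈⟨ coeff-B-suc (suc n) (suc n) ⟩
    coeff (bellTerms (suc n) id (suc (suc n))) (suc n)
      ≈⟨ trans (coeff-bellTerms-suc (suc n) id (suc n) (suc n)) (+-congˡ (coeff-bellTerms-suc (suc n) suc n (suc n))) ⟩
    coeff (bellTerm (suc n) 0) (suc n)
      + (coeff (bellTerm (suc n) 1) (suc n) + coeff (bellTerms (suc n) (suc ∘ suc) n) (suc n))
      ≈⟨ +-cong (coeff-cX*ₚ-suc _ (B (suc n)) n)
                (+-cong (coeff-cX*ₚ-suc _ (B n) n)
                        (reflexive (coeff-bellTerms-beyond (suc n) n (suc ∘ suc) s≤s (λ k → m∸n≤m n (1 ⊓ k))))) ⟩
    fromℕ 1 * coeff (B (suc n)) n + (fromℕ (suc n C 1) * coeff (B n) n + 0#)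
      ≈⟨ +-cong (trans (fromℕ[1]*x≈x _) (coeff-B[1+n][n]≈[1+n]C2 n))
                (trans (+-identityʳ _) (trans (*-congˡ (coeff-B[n][n]≈1# n)) (*-identityʳ _))) ⟩
    fromℕ (suc n C 2) + fromℕ (suc n C 1)                    ≈⟨ +-comm _ _ ⟩
    fromℕ (suc n C 1) + fromℕ (suc n C 2)                    ≈⟨ fromℕ-+ (suc n C 1) (suc n C 2) ⟨
    fromℕ (suc n C 1 ℕ.+ suc n C 2)                          ≡⟨ ≡.cong fromℕ (nCk+nC[k+1]≡[n+1]C[k+1] (suc n) 1) ⟩
    fromℕ (suc (suc n) C 2)                                  ∎

  fromℕ-stirling2[3+n,1+n] : ∀ n → let m = suc (suc n) in
    fromℕ (stirling2 (suc m) (suc n)) ≈ fromℕ (stirling2 m n) + (fromℕ m * fromℕ (suc n C 2) + fromℕ (m C 2))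
  fromℕ-stirling2[3+n,1+n] n = begin
    fromℕ (stirling2 (suc m) (suc n))                            ≡⟨ ≡.cong fromℕ (stirling2[3+n,1+n] n) ⟩
    fromℕ (stirling2 m n ℕ.+ (m ℕ.* (suc n C 2) ℕ.+ m C 2))      ≈⟨ fromℕ-+ (stirling2 m n) _ ⟩
    fromℕ (stirling2 m n) + fromℕ (m ℕ.* (suc n C 2) ℕ.+ m C 2)  ≈⟨ +-congˡ (fromℕ-+ (m ℕ.* (suc n C 2)) (m C 2)) ⟩
    fromℕ (stirling2 m n) + (fromℕ (m ℕ.* (suc n C 2)) + fromℕ (m C 2))
                                                                 ≈⟨ +-congˡ (+-congʳ (fromℕ-* m (suc n C 2))) ⟩
    fromℕ (stirling2 m n) + (fromℕ m * fromℕ (suc n C 2) + fromℕ (m C 2)) ∎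
    where m = suc (suc n)

  coeff-B[2+n][n]≈stirling2[2+n,n] : ∀ n → coeff (B (suc (suc n))) n ≈ fromℕ (stirling2 (suc (suc n)) n)
  coeff-B[2+n][n]≈stirling2[2+n,n] zero = begin
    coeff (B 2) 0                                            ≈⟨ coeff-B-suc 1 0 ⟩
    coeff (bellTerms 1 id 2) 0
      ≈⟨ trans (coeff-bellTerms-suc 1 id 1 0) (+-congˡ (coeff-bellTerms-suc 1 suc 0 0)) ⟩
    coeff (bellTerm 1 0) 0 + (coeff (bellTerm 1 1) 0 + 0#)
      ≈⟨ +-cong (coeff-cX*ₚ-zero _ (B 1)) (trans (+-identityʳ _) (coeff-cX*ₚ-zero _ (B 0))) ⟩
    0# + 0#                                                  ≈⟨ +-identityʳ 0# ⟩
    0#                                                       ∎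
  coeff-B[2+n][n]≈stirling2[2+n,n] (suc n) = begin
    coeff (B (suc (suc (suc n)))) (suc n)
      ≈⟨ coeff-B-suc (suc (suc n)) (suc n) ⟩
    coeff (bellTerms m id (suc m)) (suc n)
      ≈⟨ trans (coeff-bellTerms-suc m id (suc (suc n)) (suc n))
               (+-congˡ (trans (coeff-bellTerms-suc m suc (suc n) (suc n))
                               (+-congˡ (coeff-bellTerms-suc m (suc ∘ suc) n (suc n))))) ⟩
    coeff (bellTerm m 0) (suc n)
      + (coeff (bellTerm m 1) (suc n)
      + (coeff (bellTerm m 2) (suc n) + coeff (bellTerms m (suc ∘ suc ∘ suc) n) (suc n)))
      ≈⟨ +-cong (coeff-cX*ₚ-suc _ (B m) n)
                (+-cong (coeff-cX*ₚ-suc _ (B (suc n)) n)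
                        (+-cong (coeff-cX*ₚ-suc _ (B n) n)
                                (reflexive (coeff-bellTerms-beyond m n (suc ∘ suc ∘ suc) (s≤s ∘ s≤s)
                                                                   (λ _ → ≤-refl))))) ⟩
    fromℕ 1 * coeff (B m) n + (fromℕ (m C 1) * coeff (B (suc n)) n + (fromℕ (m C 2) * coeff (B n) n + 0#))
      ≈⟨ +-cong (trans (fromℕ[1]*x≈x _) (coeff-B[2+n][n]≈stirling2[2+n,n] n))
                (+-cong (*-cong (reflexive (≡.cong fromℕ (nC1≡n m))) (coeff-B[1+n][n]≈[1+n]C2 n))
                        (trans (+-identityʳ _) (trans (*-congˡ (coeff-B[n][n]≈1# n)) (*-identityʳ _)))) ⟩
    fromℕ (stirling2 m n) + (fromℕ m * fromℕ (suc n C 2) + fromℕ (m C 2))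
      ≈⟨ fromℕ-stirling2[3+n,1+n] n ⟨
    fromℕ (stirling2 (suc m) (suc n))                        ∎
    where m = suc (suc n)

  autCoeff≈a*coeff-B : ∀ n i → autCoeff a n i ≈ a * coeff (B n) i
  autCoeff≈a*coeff-B n i = begin
    autCoeff a n i             ≡⟨ ≡.cong (λ m → coeff (A m) i) (ℕₚ.+-comm n 4) ⟩
    coeff (A (4 ℕ.+ n)) i      ≡⟨ ≡.cong (λ p → coeff p i) (A[4+n]≡a*B[n] n) ⟩
    coeff (constₚ a *ₚ B n) i  ≈⟨ coeff-constₚ-*ₚ a (B n) i ⟩
    a * coeff (B n) i          ∎

  autCoeff[n,n]≈a : ∀ n → autCoeff a n n ≈ a
  autCoeff[n,n]≈a n =
    trans (autCoeff≈a*coeff-B n n) (trans (*-congˡ (coeff-B[n][n]≈1# n)) (*-identityʳ a))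

  autCoeff[n,n∸1]≈a*nC2 : ∀ n → 1 ≤ n → autCoeff a n (n ∸ 1) ≈ a * fromℕ (n C 2)
  autCoeff[n,n∸1]≈a*nC2 (suc n) _ =
    trans (autCoeff≈a*coeff-B (suc n) n) (*-congˡ (coeff-B[1+n][n]≈[1+n]C2 n))

  autCoeff[n,n∸2]≈a*stirling2[n,n∸2] : ∀ n → 2 ≤ n → autCoeff a n (n ∸ 2) ≈ a * fromℕ (stirling2 n (n ∸ 2))
  autCoeff[n,n∸2]≈a*stirling2[n,n∸2] 1 (s≤s ())
  autCoeff[n,n∸2]≈a*stirling2[n,n∸2] (suc (suc n)) _ =
    trans (autCoeff≈a*coeff-B (suc (suc n)) n) (*-congˡ (coeff-B[2+n][n]≈stirling2[2+n,n] n))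

mainTheorem11 : ∀ {c ℓ : Level} (R : CommutativeRing c ℓ) (a : CommutativeRing.Carrier R) →
    let open CommutativeRing R
        open Autonomous R
    in ((n : ℕ) → autCoeff a n n ≈ a)
     × ((n : ℕ) → 1 ≤ n → autCoeff a n (n ∸ 1) ≈ a * fromℕ (n C 2))
     × ((n : ℕ) → 2 ≤ n → autCoeff a n (n ∸ 2) ≈ a * fromℕ (stirling2 n (n ∸ 2)))
mainTheorem11 R a = autCoeff[n,n]≈a , autCoeff[n,n∸1]≈a*nC2 , autCoeff[n,n∸2]≈a*stirling2[n,n∸2]
  where open AutonomousCoefficients R a
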